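{- Let $H=(V,\mathcal E)$ be a $k$-uniform hypergraph with maximum degree at most $\Delta$, and let $q$ be an integer. If $\Delta\geq 2$ and $q>(\mathrm{e}\Delta k)^{\frac{1}{k-1}}$, then any edge decomposition scheme for $H$ is $\frac{1}{2}$-bounded; that is, for every ordering $e_1,\dots,e_m$ of $\mathcal E$ and every $1\le i\le m$, $$\Pr_{X\sim\mu_{i-1}}[e_i \text{ is not monochromatic in } X]\ \ge\ \frac12,$$ where $\mu_{i-1}$ is the uniform distribution over proper $q$-colourings of the hypergraph $(V,\{e_1,\dots,e_{i-1}\})$.
   Context: $k$-uniform: every hyperedge has exactly $k$ vertices. A colouring $X\in[q]^V$ is proper for a hypergraph if no hyperedge of it is monochromatic under $X$. -}

module Defs where

open import Data.Nat using (ℕ; zero; suc; _+_; _*_; _∸_; _^_; _≤_; _<_; _≥_)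
open import Data.Nat using (_!)
open import Data.Bool using (if_then_else_)
open import Data.Fin using (Fin; zero; suc; toℕ)
open import Data.Fin.Subset using (Subset; _∈_; ∣_∣)
open import Data.Fin.Subset.Properties using (_∈?_)
open import Data.Fin.Properties using (any?; all?; _≟_)
open import Data.Vec.Functional as VF using (Vector)
open import Data.List as L using (List; []; _∷_; length; filter; take; lookup)
open import Data.List.Relation.Unary.All as All using (All)
open import Data.Product using (∃; ∃-syntax; _×_; _,_)
open import Relation.Nullary using (Dec; yes; no; ¬_; does)
open import Relation.Nullary.Decidable using (_→-dec_; _×-dec_; ¬?)
open import Relation.Unary using (Pred; Decidable)
open import Relation.Binary.PropositionalEquality using (_≡_)

Colouring : ℕ → ℕ → Set
Colouring n q = Fin n → Fin q

Monochromatic : ∀ {n q} → Subset n → Colouring n q → Set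
Monochromatic {n} {q} e X = ∃[ c ] (∀ v → v ∈ e → X v ≡ c)

monochromatic? : ∀ {n q} (e : Subset n) (X : Colouring n q) → Dec (Monochromatic e X)
monochromatic? e X = any? (λ c → all? (λ v → (v ∈? e) →-dec (X v ≟ c)))

Proper : ∀ {n q} → List (Subset n) → Colouring n q → Set
Proper es X = All (λ e → ¬ Monochromatic e X) es

proper? : ∀ {n q} (es : List (Subset n)) (X : Colouring n q) → Dec (Proper es X)
proper? es X = All.all? (λ e → ¬? (monochromatic? e X)) es

sumFin : ∀ q → (Fin q → ℕ) → ℕ
sumFin zero    f = 0
sumFin (suc q) f = f zero + sumFin q (λ i → f (suc i))

countCol : ∀ n q {p} {P : Pred (Colouring n q) p} → Decidable P → ℕ
countCol zero    q P? = if does (P? (λ ())) then 1 else 0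
countCol (suc n) q P? = sumFin q (λ c → countCol n q (λ X → P? (c VF.∷ X)))

Uniform : ∀ {n} → ℕ → List (Subset n) → Set
Uniform k es = All (λ e → ∣ e ∣ ≡ k) es

degree : ∀ {n} → List (Subset n) → Fin n → ℕ
degree es v = length (filter (v ∈?_) es)

MaxDegreeAtMost : ∀ {n} → List (Subset n) → ℕ → Set
MaxDegreeAtMost es Δ = ∀ v → degree es v ≤ Δ

-- Euler's number e, via the rational upper bounds
--   U_N = Σ_{j=0}^{N} 1/j! + 1/(N · N!)   (N ≥ 1),
-- which satisfy U_N > e and U_N → e.  Hence for rational x:
--   x > e  ⇔  ∃ N ≥ 1, U_N ≤ x.
-- With T N = Σ_{j=0}^{N} N!/j!  (so T 0 = 1, T (N+1) = (N+1) · T N + 1),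
-- we have U_N · N · N! = N · T N + 1.
T : ℕ → ℕ
T zero    = 1
T (suc N) = suc N * T N + 1

-- a / b > e   (for b > 0), i.e.  a > e · b.
GtEulerTimes : ℕ → ℕ → Set
GtEulerTimes a b = ∃[ N ] (1 ≤ N × (N * T N + 1) * b ≤ a * (N * N !))

-- q > (e Δ k)^{1/(k-1)}  ⇔  q^{k-1} > e · Δ · k   (for k ≥ 2, q ≥ 0)
ColourBound : ℕ → ℕ → ℕ → Set
ColourBound q Δ k = GtEulerTimes (q ^ (k ∸ 1)) (Δ * k)

-- A counting form of the Lovász Local Lemma.  Let I be the set of the first i edges and,
-- for an edge j, let N(j) be the other edges meeting it, so |N(j)| ≤ D := k(Δ-1).  By strong
-- induction on I (ordered by inclusion) we show, for every j ∉ I, that at most a 1/(D+1)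
-- fraction of the colourings proper on I make e_j monochromatic.  Being proper on I ∖ N(j)
-- does not depend on the colours of e_j, so at most a q^(1-k) fraction of those colourings
-- make e_j monochromatic; and putting the edges of I ∩ N(j) back one at a time keeps at least
-- a D/(D+1) fraction of the proper colourings each time, by the induction hypothesis.  The
-- fraction is thus at most q^(1-k) ((D+1)/D)^D ≤ 1/(D+1), i.e. (D+1)^(D+1) ≤ q^(k-1) D^D.
-- This holds because q^(k-1) > eΔk ≥ e(D+1) and (1+1/D)^D ≤ Σ_{j≤D} 1/j! ≤ U_N for every N
-- (binomial theorem; the partial sums increase and the bounds U_N decrease).  As D ≥ 1, the
-- fraction is at most 1/2.
module Submission where

open import Defs
open import Data.Nat using (ℕ; zero; suc; _+_; _*_; _∸_; _^_; _≤_; _≥_; _≤ᵇ_; z≤n; s≤s; pred; _!; >-nonZero)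
open import Data.Nat.Properties hiding (suc-injective)
open import Data.Nat.Combinatorics using (_C_; _P_; nCk≡nPk/k!)
open import Data.Nat.Combinatorics.Base using (_P′_)
open import Data.Nat.DivMod using (_/_; m/n*n≤m)
open import Data.Nat.Tactic.RingSolver using (solve-∀)
open import Data.Bool using (true; false; if_then_else_)
open import Data.Fin using (Fin; zero; suc; toℕ)
open import Data.Fin.Properties using (toℕ<n; all?; suc-injective) renaming (_≟_ to _≟ᶠ_)
open import Data.Fin.Subset using (Subset; _∈_; _∉_; _⊆_; _⊂_; _∩_; _∪_; _─_; _-_; ⊥; ∣_∣; inside; outside; ⁅_⁆)
open import Data.Fin.Subset.Properties
  using ( _∈?_; nonempty?; ∣⊥∣≡0; ∣p∩q∣≤∣q∣; ⊆-trans; ⊂-⊆-trans; p⊂q⇒∣p∣<∣q∣; x∈⁅x⁆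
        ; x∈p∩q⁺; x∈p∩q⁻; x∈p∪q⁺; p─q⊆p; x∈p∧x∉q⇒x∈p─q; x∈p∧x≢y⇒x∈p-y; x∈p⇒p-x⊂p; x∈p⇒∣p-x∣<∣p∣ )
open import Data.Fin.Subset.Induction using (⊂-wellFounded)
open import Data.List using (List; []; _∷_; length; take; lookup)
open import Data.List.Membership.Propositional.Properties using (∈-lookup)
open import Data.List.Relation.Unary.All as All using (All; []; _∷_)
open import Data.List.Relation.Unary.Unique.Propositional using (Unique)
open import Data.Vec using ([]; _∷_; here; there; tabulate)
open import Data.Vec.Properties using (lookup⇒[]=; lookup∘tabulate)
import Data.Vec.Functional as VF
open import Data.Product using (∃-syntax; _×_; _,_; proj₁; proj₂; map₁; map₂; uncurry)
open import Data.Sum using (_⊎_; inj₁; inj₂)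
open import Function using (_∘_; case_of_)
import Induction.WellFounded as WF
open import Level using (Level; 0ℓ)
open import Relation.Nullary using (Dec; yes; no; ¬_; does; contradiction)
open import Relation.Nullary.Decidable using (_→-dec_; _×-dec_; ¬?; dec-true)
open import Relation.Unary using (Pred; Decidable; _≐_)
open import Relation.Unary.Properties using (_∩?_; ∁?)
open import Relation.Binary.PropositionalEquality using (_≡_; _≢_; refl; sym; trans; cong; cong₂)
import Algebra.Properties.CommutativeSemigroup as CommSemigroupProperties
import Algebra.Properties.CommutativeSemiring.Binomial as Binomial

open ≤-Reasoning

private
  variable
    ℓ ℓ′ ℓ″ : Level

  module +ℕ = CommSemigroupProperties +-commutativeSemigroup
  module *ℕ = CommSemigroupProperties *-commutativeSemigroup

-- Finite subsets

x∈p─q⇒x∉q : ∀ {n} {x : Fin n} (p q : Subset n) → x ∈ p ─ q → x ∉ q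
x∈p─q⇒x∉q (_ ∷ p) (outside ∷ q) here          ()
x∈p─q⇒x∉q (_ ∷ p) (_       ∷ q) (there x∈p─q) (there x∈q) = x∈p─q⇒x∉q p q x∈p─q x∈q

x∉p-x : ∀ {n} (p : Subset n) x → x ∉ p - x
x∉p-x p x x∈p-x = x∈p─q⇒x∉q p ⁅ x ⁆ x∈p-x (x∈⁅x⁆ x)

∣p∪q∣≤∣p∣+∣q∣ : ∀ {n} (p q : Subset n) → ∣ p ∪ q ∣ ≤ ∣ p ∣ + ∣ q ∣
∣p∪q∣≤∣p∣+∣q∣ []            []            = z≤n
∣p∪q∣≤∣p∣+∣q∣ (outside ∷ p) (outside ∷ q) = ∣p∪q∣≤∣p∣+∣q∣ p q
∣p∪q∣≤∣p∣+∣q∣ (outside ∷ p) (inside  ∷ q) =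
  ≤-trans (s≤s (∣p∪q∣≤∣p∣+∣q∣ p q)) (≤-reflexive (sym (+-suc ∣ p ∣ ∣ q ∣)))
∣p∪q∣≤∣p∣+∣q∣ (inside  ∷ p) (outside ∷ q) = s≤s (∣p∪q∣≤∣p∣+∣q∣ p q)
∣p∪q∣≤∣p∣+∣q∣ (inside  ∷ p) (inside  ∷ q) =
  s≤s (≤-trans (∣p∪q∣≤∣p∣+∣q∣ p q) (+-monoʳ-≤ ∣ p ∣ (n≤1+n ∣ q ∣)))

⋃∈ : ∀ {n m} → Subset n → (Fin n → Subset m) → Subset m
⋃∈ []            g = ⊥
⋃∈ (inside  ∷ f) g = g zero ∪ ⋃∈ f (g ∘ suc)
⋃∈ (outside ∷ f) g = ⋃∈ f (g ∘ suc)

∈-⋃∈ : ∀ {n m} {f : Subset n} {g : Fin n → Subset m} {v j} → v ∈ f → j ∈ g v → j ∈ ⋃∈ f g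
∈-⋃∈ {f = inside  ∷ f} here        j∈gv = x∈p∪q⁺ (inj₁ j∈gv)
∈-⋃∈ {f = inside  ∷ f} (there v∈f) j∈gv = x∈p∪q⁺ (inj₂ (∈-⋃∈ v∈f j∈gv))
∈-⋃∈ {f = outside ∷ f} (there v∈f) j∈gv = ∈-⋃∈ v∈f j∈gv

∣⋃∈∣≤ : ∀ {n m} (f : Subset n) {g : Fin n → Subset m} {b} →
        (∀ {v} → v ∈ f → ∣ g v ∣ ≤ b) → ∣ ⋃∈ f g ∣ ≤ ∣ f ∣ * b
∣⋃∈∣≤ {m = m} []                      _     = ≤-reflexive (∣⊥∣≡0 m)
∣⋃∈∣≤         (inside  ∷ f) {g} {b} ∣g∣≤b = begin
  ∣ g zero ∪ ⋃∈ f (g ∘ suc) ∣            ≤⟨ ∣p∪q∣≤∣p∣+∣q∣ (g zero) (⋃∈ f (g ∘ suc)) ⟩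
  ∣ g zero ∣ + ∣ ⋃∈ f (g ∘ suc) ∣        ≤⟨ +-mono-≤ (∣g∣≤b here) (∣⋃∈∣≤ f (∣g∣≤b ∘ there)) ⟩
  b + ∣ f ∣ * b                           ∎
∣⋃∈∣≤         (outside ∷ f)         ∣g∣≤b = ∣⋃∈∣≤ f (∣g∣≤b ∘ there)

-- Sums over Fin and Euler's number

sumFin-mono : ∀ q {f g : Fin q → ℕ} → (∀ i → f i ≤ g i) → sumFin q f ≤ sumFin q g
sumFin-mono zero    f≤g = z≤n
sumFin-mono (suc q) f≤g = +-mono-≤ (f≤g zero) (sumFin-mono q (f≤g ∘ suc))

sumFin-cong : ∀ q {f g : Fin q → ℕ} → (∀ i → f i ≡ g i) → sumFin q f ≡ sumFin q g
sumFin-cong zero    f≗g = refl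
sumFin-cong (suc q) f≗g = cong₂ _+_ (f≗g zero) (sumFin-cong q (f≗g ∘ suc))

sumFin-distrib-+ : ∀ q (f g : Fin q → ℕ) → sumFin q (λ i → f i + g i) ≡ sumFin q f + sumFin q g
sumFin-distrib-+ zero    f g = refl
sumFin-distrib-+ (suc q) f g =
  trans (cong (f zero + g zero +_) (sumFin-distrib-+ q (f ∘ suc) (g ∘ suc)))
        (+ℕ.interchange (f zero) (g zero) (sumFin q (f ∘ suc)) (sumFin q (g ∘ suc)))

*-distribˡ-sumFin : ∀ q c (f : Fin q → ℕ) → c * sumFin q f ≡ sumFin q (λ i → c * f i)
*-distribˡ-sumFin zero    c f = *-zeroʳ c
*-distribˡ-sumFin (suc q) c f =
  trans (*-distribˡ-+ c (f zero) _) (cong (c * f zero +_) (*-distribˡ-sumFin q c (f ∘ suc)))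

*-distribʳ-sumFin : ∀ q c (f : Fin q → ℕ) → sumFin q f * c ≡ sumFin q (λ i → f i * c)
*-distribʳ-sumFin zero    c f = refl
*-distribʳ-sumFin (suc q) c f =
  trans (*-distribʳ-+ c (f zero) _) (cong (f zero * c +_) (*-distribʳ-sumFin q c (f ∘ suc)))

sumFin-const : ∀ q x → sumFin q (λ _ → x) ≡ q * x
sumFin-const zero    x = refl
sumFin-const (suc q) x = cong (x +_) (sumFin-const q x)

sumFin-pointed : ∀ q {f : Fin q → ℕ} i → (∀ j → j ≢ i → f j ≡ 0) → sumFin q f ≡ f i
sumFin-pointed (suc q) {f} zero    f≡0 = begin-equality
  f zero + sumFin q (f ∘ suc)  ≡⟨ cong (f zero +_) (sumFin-cong q λ j → f≡0 (suc j) λ ()) ⟩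
  f zero + sumFin q (λ _ → 0)  ≡⟨ cong (f zero +_) (trans (sumFin-const q 0) (*-zeroʳ q)) ⟩
  f zero + 0                   ≡⟨ +-identityʳ (f zero) ⟩
  f zero                       ∎
sumFin-pointed (suc q) {f} (suc i) f≡0 =
  cong₂ _+_ (f≡0 zero λ ()) (sumFin-pointed q i λ j j≢i → f≡0 (suc j) (j≢i ∘ suc-injective))

binomial-theorem : ∀ n x y →
  (x + y) ^ n ≡ sumFin (suc n) (λ k → (n C toℕ k) * (x ^ toℕ k * y ^ (n ∸ toℕ k)))
binomial-theorem n x y = begin-equality
  (x + y) ^ n                       ≡⟨ ^≡^ (x + y) n ⟩
  (x + y) S.^ n                     ≡⟨ S.theorem n x y ⟩
  S.binomialExpansion x y n         ≡⟨ sum≡sumFin (suc n) (S.binomialTerm x y n) ⟩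
  sumFin (suc n) (λ k → (n C toℕ k) S.× (x S.^ toℕ k * y S.^ (n ∸ toℕ k)))
    ≡⟨ sumFin-cong (suc n) (λ k → trans (×≡* (n C toℕ k) _)
         (cong ((n C toℕ k) *_) (sym (cong₂ _*_ (^≡^ x (toℕ k)) (^≡^ y (n ∸ toℕ k)))))) ⟩
  sumFin (suc n) (λ k → (n C toℕ k) * (x ^ toℕ k * y ^ (n ∸ toℕ k))) ∎
  where
  module S where
    open Binomial +-*-commutativeSemiring public
    open import Algebra.Properties.Semiring.Exp +-*-semiring public using (_^_)
    open import Algebra.Properties.Semiring.Sum +-*-semiring public using (sum)
    open import Algebra.Properties.Semiring.Mult +-*-semiring public using (_×_)
  ^≡^ : ∀ x n → x ^ n ≡ x S.^ n
  ^≡^ x zero    = refl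
  ^≡^ x (suc n) = cong (x *_) (^≡^ x n)
  ×≡* : ∀ n x → n S.× x ≡ n * x
  ×≡* zero    x = refl
  ×≡* (suc n) x = cong (x +_) (×≡* n x)
  sum≡sumFin : ∀ n (f : Fin n → ℕ) → S.sum f ≡ sumFin n f
  sum≡sumFin zero    f = refl
  sum≡sumFin (suc n) f = cong (f zero +_) (sum≡sumFin n (f ∘ suc))

P′-suc : ∀ n k → suc n P′ suc k ≡ suc n * (n P′ k)
P′-suc n zero    = refl
P′-suc n (suc k) = trans (cong ((n ∸ k) *_) (P′-suc n k)) (*ℕ.x∙yz≈y∙xz (n ∸ k) (suc n) (n P′ k))

T≡∑P′ : ∀ N → T N ≡ sumFin (suc N) (λ k → N P′ toℕ k)
T≡∑P′ zero    = refl
T≡∑P′ (suc N) = begin-equality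
  suc N * T N + 1                                  ≡⟨ +-comm (suc N * T N) 1 ⟩
  1 + suc N * T N                                  ≡⟨ cong (λ t → 1 + suc N * t) (T≡∑P′ N) ⟩
  1 + suc N * sumFin (suc N) (λ k → N P′ toℕ k)     ≡⟨ cong (1 +_) (*-distribˡ-sumFin (suc N) (suc N) (λ k → N P′ toℕ k)) ⟩
  1 + sumFin (suc N) (λ k → suc N * (N P′ toℕ k))   ≡⟨ cong (1 +_) (sumFin-cong (suc N) (λ k → P′-suc N (toℕ k))) ⟨
  1 + sumFin (suc N) (λ k → suc N P′ suc (toℕ k))   ∎

[k+t]!≤k!*n^t : ∀ k t {n} → k + t ≤ n → (k + t) ! ≤ k ! * n ^ t
[k+t]!≤k!*n^t k zero    _ = ≤-reflexive (trans (cong _! (+-identityʳ k)) (sym (*-identityʳ (k !))))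
[k+t]!≤k!*n^t k (suc t) {n} k+t<n rewrite +-suc k t = begin
  suc (k + t) * (k + t) !  ≤⟨ *-mono-≤ k+t<n ([k+t]!≤k!*n^t k t (<⇒≤ k+t<n)) ⟩
  n * (k ! * n ^ t)        ≡⟨ *ℕ.x∙yz≈y∙xz n (k !) (n ^ t) ⟩
  k ! * (n * n ^ t)        ∎

C*!≤P′ : ∀ {n k} → k ≤ n → (n C k) * k ! ≤ n P′ k
C*!≤P′ {n} {k} k≤n = begin
  (n C k) * k !                     ≡⟨ cong (_* k !) (nCk≡nPk/k! k≤n) ⟩
  ((n P k) / k !) {{k !≢0}} * k !   ≤⟨ m/n*n≤m (n P k) (k !) {{k !≢0}} ⟩
  n P k                             ≤⟨ P≤P′ ⟩
  n P′ k                            ∎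
  where
  P≤P′ : n P k ≤ n P′ k
  P≤P′ with k ≤ᵇ n
  ... | true  = ≤-refl
  ... | false = z≤n

binomialTerm≤ : ∀ {D k} → k ≤ D → (D C k) * D ^ k * D ! ≤ D ^ D * (D P′ k)
binomialTerm≤ {D} {k} k≤D = begin
  (D C k) * D ^ k * D !
    ≡⟨ cong (λ d → (D C k) * D ^ k * d !) k+[D∸k]≡D ⟨
  (D C k) * D ^ k * (k + (D ∸ k)) !
    ≤⟨ *-monoʳ-≤ ((D C k) * D ^ k) ([k+t]!≤k!*n^t k (D ∸ k) (≤-reflexive k+[D∸k]≡D)) ⟩
  (D C k) * D ^ k * (k ! * D ^ (D ∸ k))
    ≡⟨ *ℕ.interchange (D C k) (D ^ k) (k !) (D ^ (D ∸ k)) ⟩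
  (D C k) * k ! * (D ^ k * D ^ (D ∸ k))
    ≡⟨ cong ((D C k) * k ! *_) (trans (sym (^-distribˡ-+-* D k (D ∸ k))) (cong (D ^_) k+[D∸k]≡D)) ⟩
  (D C k) * k ! * D ^ D
    ≤⟨ *-monoˡ-≤ (D ^ D) (C*!≤P′ k≤D) ⟩
  (D P′ k) * D ^ D
    ≡⟨ *-comm (D P′ k) (D ^ D) ⟩
  D ^ D * (D P′ k)
    ∎
  where
  k+[D∸k]≡D : k + (D ∸ k) ≡ D
  k+[D∸k]≡D = m+[n∸m]≡n k≤D

[1+D]^D*D!≤D^D*T : ∀ D → suc D ^ D * D ! ≤ D ^ D * T D
[1+D]^D*D!≤D^D*T D = begin
  suc D ^ D * D !
    ≡⟨ cong (λ x → x ^ D * D !) (+-comm 1 D) ⟩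
  (D + 1) ^ D * D !
    ≡⟨ cong (_* D !) (binomial-theorem D D 1) ⟩
  sumFin (suc D) term * D !
    ≡⟨ *-distribʳ-sumFin (suc D) (D !) term ⟩
  sumFin (suc D) (λ k → term k * D !)
    ≤⟨ sumFin-mono (suc D) term*D!≤ ⟩
  sumFin (suc D) (λ k → D ^ D * (D P′ toℕ k))
    ≡⟨ *-distribˡ-sumFin (suc D) (D ^ D) (λ k → D P′ toℕ k) ⟨
  D ^ D * sumFin (suc D) (λ k → D P′ toℕ k)
    ≡⟨ cong (D ^ D *_) (T≡∑P′ D) ⟨
  D ^ D * T D
    ∎
  where
  term : Fin (suc D) → ℕ
  term k = (D C toℕ k) * (D ^ toℕ k * 1 ^ (D ∸ toℕ k))
  term*D!≤ : ∀ k → term k * D ! ≤ D ^ D * (D P′ toℕ k)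
  term*D!≤ k rewrite ^-zeroˡ (D ∸ toℕ k) | *-identityʳ (D ^ toℕ k) = binomialTerm≤ (≤-pred (toℕ<n k))

T/!-mono : ∀ D t → (D + t) ! * T D ≤ T (D + t) * D !
T/!-mono D zero    rewrite +-identityʳ D = ≤-reflexive (*-comm (D !) (T D))
T/!-mono D (suc t) rewrite +-suc D t = begin
  suc (D + t) * (D + t) ! * T D      ≡⟨ *-assoc (suc (D + t)) ((D + t) !) (T D) ⟩
  suc (D + t) * ((D + t) ! * T D)    ≤⟨ *-monoʳ-≤ (suc (D + t)) (T/!-mono D t) ⟩
  suc (D + t) * (T (D + t) * D !)    ≡⟨ *-assoc (suc (D + t)) (T (D + t)) (D !) ⟨
  suc (D + t) * T (D + t) * D !      ≤⟨ *-monoˡ-≤ (D !) (m≤m+n (suc (D + t) * T (D + t)) 1) ⟩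
  (suc (D + t) * T (D + t) + 1) * D ! ∎

U-antitone : ∀ N t → 1 ≤ N →
  ((N + t) * T (N + t) + 1) * (N * N !) ≤ (N * T N + 1) * ((N + t) * (N + t) !)
U-antitone N zero    _   rewrite +-identityʳ N = ≤-refl
U-antitone N (suc t) 1≤N rewrite +-suc N t =
  *-cancelˡ-≤ M {{>-nonZero (≤-trans 1≤N (m≤m+n N t))}} (begin
    M * ((suc M * T (suc M) + 1) * N*N!)          ≡⟨ *-assoc M (suc M * T (suc M) + 1) N*N! ⟨
    M * (suc M * T (suc M) + 1) * N*N!            ≤⟨ *-monoˡ-≤ N*N! (≤-trans (m≤m+n _ 1) (≤-reflexive (cross-multiplied M (T M)))) ⟩
    suc M * suc M * (M * T M + 1) * N*N!          ≡⟨ *-assoc (suc M * suc M) (M * T M + 1) N*N! ⟩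
    suc M * suc M * ((M * T M + 1) * N*N!)        ≤⟨ *-monoʳ-≤ (suc M * suc M) (U-antitone N t 1≤N) ⟩
    suc M * suc M * ((N * T N + 1) * (M * M !))   ≡⟨ rearrange M (N * T N + 1) (M !) ⟩
    M * ((N * T N + 1) * (suc M * (suc M * M !))) ∎)
  where
  M N*N! : ℕ
  M = N + t
  N*N! = N * N !
  cross-multiplied : ∀ M t → M * (suc M * (suc M * t + 1) + 1) + 1 ≡ suc M * suc M * (M * t + 1)
  cross-multiplied = solve-∀
  rearrange : ∀ M a f → suc M * suc M * (a * (M * f)) ≡ M * (a * (suc M * (suc M * f)))
  rearrange = solve-∀

T/!≤U : ∀ D N → 1 ≤ N → T D * (N * N !) ≤ (N * T N + 1) * D !
T/!≤U D N 1≤N with ≤-total D N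
... | inj₁ D≤N with t , refl ← m≤n⇒∃[o]m+o≡n D≤N = begin
  T D * ((D + t) * (D + t) !)       ≡⟨ *ℕ.x∙yz≈y∙xz (T D) (D + t) ((D + t) !) ⟩
  (D + t) * (T D * (D + t) !)       ≡⟨ cong ((D + t) *_) (*-comm (T D) ((D + t) !)) ⟩
  (D + t) * ((D + t) ! * T D)       ≤⟨ *-monoʳ-≤ (D + t) (T/!-mono D t) ⟩
  (D + t) * (T (D + t) * D !)       ≡⟨ *-assoc (D + t) (T (D + t)) (D !) ⟨
  (D + t) * T (D + t) * D !         ≤⟨ *-monoˡ-≤ (D !) (m≤m+n ((D + t) * T (D + t)) 1) ⟩
  ((D + t) * T (D + t) + 1) * D !   ∎
... | inj₂ N≤D with t , refl ← m≤n⇒∃[o]m+o≡n N≤D =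
  *-cancelˡ-≤ (N + t) {{>-nonZero (≤-trans 1≤N (m≤m+n N t))}} (begin
    (N + t) * (T (N + t) * (N * N !))        ≡⟨ *-assoc (N + t) (T (N + t)) (N * N !) ⟨
    (N + t) * T (N + t) * (N * N !)          ≤⟨ *-monoˡ-≤ (N * N !) (m≤m+n ((N + t) * T (N + t)) 1) ⟩
    ((N + t) * T (N + t) + 1) * (N * N !)    ≤⟨ U-antitone N t 1≤N ⟩
    (N * T N + 1) * ((N + t) * (N + t) !)    ≡⟨ *ℕ.x∙yz≈y∙xz (N * T N + 1) (N + t) ((N + t) !) ⟩
    (N + t) * ((N * T N + 1) * (N + t) !)    ∎)

[1+D]^D≤U : ∀ D N → 1 ≤ N → suc D ^ D * (N * N !) ≤ (N * T N + 1) * D ^ D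
[1+D]^D≤U D N 1≤N = *-cancelʳ-≤ _ _ (D !) {{D !≢0}} (begin
  suc D ^ D * (N * N !) * D !        ≡⟨ *ℕ.xy∙z≈xz∙y (suc D ^ D) (N * N !) (D !) ⟩
  suc D ^ D * D ! * (N * N !)        ≤⟨ *-monoˡ-≤ (N * N !) ([1+D]^D*D!≤D^D*T D) ⟩
  D ^ D * T D * (N * N !)            ≡⟨ *-assoc (D ^ D) (T D) (N * N !) ⟩
  D ^ D * (T D * (N * N !))          ≤⟨ *-monoʳ-≤ (D ^ D) (T/!≤U D N 1≤N) ⟩
  D ^ D * ((N * T N + 1) * D !)      ≡⟨ *ℕ.x∙yz≈yx∙z (D ^ D) (N * T N + 1) (D !) ⟩
  (N * T N + 1) * D ^ D * D !        ∎)

GtEulerTimes⇒[1+D]^[1+D]≤*D^D : ∀ {a b D} → GtEulerTimes a b → suc D ≤ b → suc D ^ suc D ≤ a * D ^ D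
GtEulerTimes⇒[1+D]^[1+D]≤*D^D {a} {b} {D} (N , 1≤N , U*b≤a*N*N!) 1+D≤b =
  *-cancelʳ-≤ _ _ (N * N !) {{m*n≢0 N (N !) {{>-nonZero 1≤N}} {{N !≢0}}}} (begin
    suc D * suc D ^ D * (N * N !)    ≡⟨ *-assoc (suc D) (suc D ^ D) (N * N !) ⟩
    suc D * (suc D ^ D * (N * N !))  ≤⟨ *-mono-≤ 1+D≤b ([1+D]^D≤U D N 1≤N) ⟩
    b * ((N * T N + 1) * D ^ D)      ≡⟨ *ℕ.x∙yz≈yx∙z b (N * T N + 1) (D ^ D) ⟩
    (N * T N + 1) * b * D ^ D        ≤⟨ *-monoˡ-≤ (D ^ D) U*b≤a*N*N! ⟩
    a * (N * N !) * D ^ D            ≡⟨ *ℕ.xy∙z≈xz∙y a (N * N !) (D ^ D) ⟩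
    a * D ^ D * (N * N !)            ∎)

-- Counting colourings

𝟙 : ∀ {A : Set ℓ} → Dec A → ℕ
𝟙 a? = if does a? then 1 else 0

𝟙-mono : ∀ {A : Set ℓ} {B : Set ℓ′} (a? : Dec A) (b? : Dec B) → (A → B) → 𝟙 a? ≤ 𝟙 b?
𝟙-mono (yes a) (yes _) _   = ≤-refl
𝟙-mono (yes a) (no ¬b) A→B = contradiction (A→B a) ¬b
𝟙-mono (no _)  _       _   = z≤n

𝟙-split : ∀ {A : Set ℓ} {B : Set ℓ′} (a? : Dec A) (b? : Dec B) → 𝟙 a? ≡ 𝟙 (a? ×-dec ¬? b?) + 𝟙 (a? ×-dec b?)
𝟙-split (yes _) (yes _) = refl
𝟙-split (yes _) (no _)  = refl
𝟙-split (no _)  _       = refl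

𝟙-no : ∀ {A : Set ℓ} (a? : Dec A) → ¬ A → 𝟙 a? ≡ 0
𝟙-no (yes a) ¬a = contradiction a ¬a
𝟙-no (no _)  _  = refl

ConstantOn : ∀ {n q} → Subset n → Fin q → Colouring n q → Set
ConstantOn f c X = ∀ v → v ∈ f → X v ≡ c

constantOn? : ∀ {n q} (f : Subset n) (c : Fin q) → Decidable (ConstantOn f c)
constantOn? f c X = all? λ v → (v ∈? f) →-dec (X v ≟ᶠ c)

constantOn-tail : ∀ {n q s} {f : Subset n} {c c′ : Fin q} {X} → ConstantOn (s ∷ f) c (c′ VF.∷ X) → ConstantOn f c X
constantOn-tail X≡c v v∈f = X≡c (suc v) (there v∈f)

IgnoresColoursOn : ∀ {n q} → Subset n → Pred (Colouring n q) ℓ → Set ℓ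
IgnoresColoursOn f Q = ∀ {X Y} → (∀ v → v ∉ f → X v ≡ Y v) → Q X → Q Y

module _ {q : ℕ} where

  ignoresColoursOn-tail : ∀ {n s} {f : Subset n} {Q : Pred (Colouring (suc n) q) ℓ} c →
                          IgnoresColoursOn (s ∷ f) Q → IgnoresColoursOn f (Q ∘ (c VF.∷_))
  ignoresColoursOn-tail c ignores X≡Y = ignores λ where
    zero    _     → refl
    (suc v) v∉s∷f → X≡Y v (v∉s∷f ∘ there)

  ignoresColoursOn-head : ∀ {n} {f : Subset n} {Q : Pred (Colouring (suc n) q) ℓ} {X} c c′ →
                          IgnoresColoursOn (inside ∷ f) Q → Q (c VF.∷ X) → Q (c′ VF.∷ X)
  ignoresColoursOn-head c c′ ignores = ignores λ where
    zero    0∉ → contradiction here 0∉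
    (suc v) _  → refl

  countCol-mono : ∀ n {P : Pred (Colouring n q) ℓ} {Q : Pred (Colouring n q) ℓ′} (P? : Decidable P) (Q? : Decidable Q) →
                  (∀ {X} → P X → Q X) → countCol n q P? ≤ countCol n q Q?
  countCol-mono zero    P? Q? P⊆Q = 𝟙-mono (P? _) (Q? _) P⊆Q
  countCol-mono (suc n) P? Q? P⊆Q = sumFin-mono q λ c → countCol-mono n (P? ∘ (c VF.∷_)) (Q? ∘ (c VF.∷_)) P⊆Q

  countCol-cong : ∀ n {P : Pred (Colouring n q) ℓ} {Q : Pred (Colouring n q) ℓ′} (P? : Decidable P) (Q? : Decidable Q) →
                  P ≐ Q → countCol n q P? ≡ countCol n q Q?
  countCol-cong n P? Q? (P⊆Q , Q⊆P) = ≤-antisym (countCol-mono n P? Q? P⊆Q) (countCol-mono n Q? P? Q⊆P)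

  countCol-empty : ∀ n {P : Pred (Colouring n q) ℓ} (P? : Decidable P) → (∀ {X} → ¬ P X) → countCol n q P? ≡ 0
  countCol-empty zero    P? ¬P = 𝟙-no (P? _) ¬P
  countCol-empty (suc n) P? ¬P = begin-equality
    sumFin q (λ c → countCol n q (P? ∘ (c VF.∷_)))  ≡⟨ sumFin-cong q (λ c → countCol-empty n (P? ∘ (c VF.∷_)) ¬P) ⟩
    sumFin q (λ _ → 0)                             ≡⟨ sumFin-const q 0 ⟩
    q * 0                                          ≡⟨ *-zeroʳ q ⟩
    0                                              ∎

  countCol-split : ∀ n {P : Pred (Colouring n q) ℓ} {Q : Pred (Colouring n q) ℓ′} (P? : Decidable P) (Q? : Decidable Q) →
                   countCol n q P? ≡ countCol n q (P? ∩? ∁? Q?) + countCol n q (P? ∩? Q?)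
  countCol-split zero    P? Q? = 𝟙-split (P? _) (Q? _)
  countCol-split (suc n) P? Q? =
    trans (sumFin-cong q λ c → countCol-split n (P? ∘ (c VF.∷_)) (Q? ∘ (c VF.∷_))) (sumFin-distrib-+ q _ _)

  countCol-∪ : ∀ n {R : Pred (Colouring n q) ℓ} {P : Pred (Colouring n q) ℓ′} {Q : Pred (Colouring n q) ℓ″}
               (R? : Decidable R) (P? : Decidable P) (Q? : Decidable Q) →
               (∀ {X} → R X → P X ⊎ Q X) → countCol n q R? ≤ countCol n q P? + countCol n q Q?
  countCol-∪ n {R} {P} {Q} R? P? Q? R⊆P∪Q = begin
    countCol n q R?
      ≡⟨ countCol-split n R? P? ⟩
    countCol n q (R? ∩? ∁? P?) + countCol n q (R? ∩? P?)
      ≤⟨ +-mono-≤ (countCol-mono n _ Q? R∖P⊆Q) (countCol-mono n _ P? proj₂) ⟩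
    countCol n q Q? + countCol n q P?
      ≡⟨ +-comm (countCol n q Q?) (countCol n q P?) ⟩
    countCol n q P? + countCol n q Q?
      ∎
    where
    R∖P⊆Q : ∀ {X} → R X × ¬ P X → Q X
    R∖P⊆Q (RX , ¬PX) with R⊆P∪Q RX
    ... | inj₁ PX = contradiction PX ¬PX
    ... | inj₂ QX = QX

  countCol-⋃ : ∀ n r {R : Pred (Colouring n q) ℓ} {A : Fin r → Pred (Colouring n q) ℓ′}
               (R? : Decidable R) (A? : ∀ i → Decidable (A i)) →
               (∀ {X} → R X → ∃[ i ] A i X) → countCol n q R? ≤ sumFin r (λ i → countCol n q (A? i))
  countCol-⋃ n zero    R? A? R⊆⋃A = ≤-reflexive (countCol-empty n R? λ RX → case R⊆⋃A RX of λ ())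
  countCol-⋃ n (suc r) {R} {A} R? A? R⊆⋃A = begin
    countCol n q R?
      ≤⟨ countCol-∪ n R? (A? zero) (R? ∩? ∁? (A? zero)) R⊆A₀∪R∖A₀ ⟩
    countCol n q (A? zero) + countCol n q (R? ∩? ∁? (A? zero))
      ≤⟨ +-monoʳ-≤ (countCol n q (A? zero)) (countCol-⋃ n r _ (A? ∘ suc) R∖A₀⊆⋃A) ⟩
    countCol n q (A? zero) + sumFin r (λ i → countCol n q (A? (suc i)))
      ∎
    where
    R⊆A₀∪R∖A₀ : ∀ {X} → R X → A zero X ⊎ (R X × ¬ A zero X)
    R⊆A₀∪R∖A₀ {X} RX with A? zero X
    ... | yes A₀X = inj₁ A₀X
    ... | no ¬A₀X = inj₂ (RX , ¬A₀X)
    R∖A₀⊆⋃A : ∀ {X} → R X × ¬ A zero X → ∃[ i ] A (suc i) X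
    R∖A₀⊆⋃A (RX , ¬A₀X) with R⊆⋃A RX
    ... | zero  , A₀X = contradiction A₀X ¬A₀X
    ... | suc i , AᵢX = i , AᵢX

  countCol-constantOn : ∀ n (f : Subset n) (c : Fin q) {Q : Pred (Colouring n q) ℓ} (Q? : Decidable Q) →
                        IgnoresColoursOn f Q → countCol n q (Q? ∩? constantOn? f c) * q ^ ∣ f ∣ ≤ countCol n q Q?
  countCol-constantOn zero [] c Q? _ = begin
    countCol 0 q (Q? ∩? constantOn? [] c) * 1  ≡⟨ *-identityʳ _ ⟩
    countCol 0 q (Q? ∩? constantOn? [] c)      ≤⟨ countCol-mono 0 (Q? ∩? constantOn? [] c) Q? proj₁ ⟩
    countCol 0 q Q?                            ∎
  countCol-constantOn (suc n) (outside ∷ f) c {Q} Q? ignores = begin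
    sumFin q (λ c′ → countCol n q (Q?∣ c′ ∩? constantOn? (outside ∷ f) c ∘ (c′ VF.∷_))) * q ^ ∣ f ∣
      ≡⟨ *-distribʳ-sumFin q (q ^ ∣ f ∣) _ ⟩
    sumFin q (λ c′ → countCol n q (Q?∣ c′ ∩? constantOn? (outside ∷ f) c ∘ (c′ VF.∷_)) * q ^ ∣ f ∣)
      ≤⟨ sumFin-mono q (λ c′ → *-monoˡ-≤ (q ^ ∣ f ∣) (countCol-mono n _ _ (map₂ constantOn-tail))) ⟩
    sumFin q (λ c′ → countCol n q (Q?∣ c′ ∩? constantOn? f c) * q ^ ∣ f ∣)
      ≤⟨ sumFin-mono q (λ c′ → countCol-constantOn n f c (Q?∣ c′) (ignoresColoursOn-tail c′ ignores)) ⟩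
    sumFin q (λ c′ → countCol n q (Q?∣ c′))
      ∎
    where
    Q?∣ : ∀ c′ → Decidable (Q ∘ (c′ VF.∷_))
    Q?∣ c′ = Q? ∘ (c′ VF.∷_)
  countCol-constantOn (suc n) (inside ∷ f) c {Q} Q? ignores = begin
    sumFin q g * (q * q ^ ∣ f ∣)                ≡⟨ cong (_* (q * q ^ ∣ f ∣)) (sumFin-pointed q c g≡0) ⟩
    g c * (q * q ^ ∣ f ∣)                       ≤⟨ *-monoˡ-≤ (q * q ^ ∣ f ∣) (countCol-mono n _ _ (map₂ constantOn-tail)) ⟩
    #constant * (q * q ^ ∣ f ∣)                 ≡⟨ *ℕ.x∙yz≈y∙xz #constant q (q ^ ∣ f ∣) ⟩
    q * (#constant * q ^ ∣ f ∣)                 ≤⟨ *-monoʳ-≤ q (countCol-constantOn n f c (Q?∣ c) (ignoresColoursOn-tail c ignores)) ⟩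
    q * countCol n q (Q?∣ c)                    ≡⟨ sumFin-const q _ ⟨
    sumFin q (λ _ → countCol n q (Q?∣ c))       ≡⟨ sumFin-cong q (λ c′ → countCol-cong n _ _ (recolour c c′ , recolour c′ c)) ⟩
    sumFin q (λ c′ → countCol n q (Q?∣ c′))     ∎
    where
    Q?∣ : ∀ c′ → Decidable (Q ∘ (c′ VF.∷_))
    Q?∣ c′ = Q? ∘ (c′ VF.∷_)
    g : Fin q → ℕ
    g c′ = countCol n q (Q?∣ c′ ∩? constantOn? (inside ∷ f) c ∘ (c′ VF.∷_))
    g≡0 : ∀ c′ → c′ ≢ c → g c′ ≡ 0
    g≡0 c′ c′≢c = countCol-empty n _ λ (_ , X≡c) → c′≢c (X≡c zero here)
    #constant : ℕ
    #constant = countCol n q (Q?∣ c ∩? constantOn? f c)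
    recolour : ∀ c₁ c₂ {X} → Q (c₁ VF.∷ X) → Q (c₂ VF.∷ X)
    recolour c₁ c₂ = ignoresColoursOn-head c₁ c₂ ignores

  countCol-monochromatic≤∑constantOn : ∀ n (f : Subset n) {Q : Pred (Colouring n q) ℓ} (Q? : Decidable Q) →
    countCol n q (Q? ∩? monochromatic? f) ≤ sumFin q (λ c → countCol n q (Q? ∩? constantOn? f c))
  countCol-monochromatic≤∑constantOn n f Q? =
    countCol-⋃ n q (Q? ∩? monochromatic? f) (λ c → Q? ∩? constantOn? f c) λ (QX , c , X≡c) → c , QX , X≡c

countCol-monochromatic : ∀ n {q} (f : Subset n) {k} {Q : Pred (Colouring n q) ℓ} (Q? : Decidable Q) →
                         IgnoresColoursOn f Q → ∣ f ∣ ≡ suc k →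
                         countCol n q (Q? ∩? monochromatic? f) * q ^ k ≤ countCol n q Q?
countCol-monochromatic n {zero} f {k} Q? _ _ =
  ≤-trans (*-monoˡ-≤ (0 ^ k) (countCol-monochromatic≤∑constantOn n f Q?)) z≤n
countCol-monochromatic n {q@(suc _)} f {k} Q? ignores ∣f∣≡1+k = *-cancelˡ-≤ q (begin
  q * (#mono * q ^ k)                ≡⟨ *ℕ.x∙yz≈y∙xz q #mono (q ^ k) ⟩
  #mono * q ^ suc k                  ≡⟨ cong (λ i → #mono * q ^ i) ∣f∣≡1+k ⟨
  #mono * q ^ ∣ f ∣                  ≤⟨ *-monoˡ-≤ (q ^ ∣ f ∣) (countCol-monochromatic≤∑constantOn n f Q?) ⟩
  sumFin q #constant * q ^ ∣ f ∣     ≡⟨ *-distribʳ-sumFin q (q ^ ∣ f ∣) #constant ⟩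
  sumFin q (λ c → #constant c * q ^ ∣ f ∣)
                                     ≤⟨ sumFin-mono q (λ c → countCol-constantOn n f c Q? ignores) ⟩
  sumFin q (λ _ → countCol n q Q?)   ≡⟨ sumFin-const q _ ⟩
  q * countCol n q Q?                ∎)
  where
  #mono : ℕ
  #mono = countCol n q (Q? ∩? monochromatic? f)
  #constant : Fin q → ℕ
  #constant c = countCol n q (Q? ∩? constantOn? f c)

-- The local lemma, counting version

module CountingLocalLemma {n q m : ℕ} (E : Fin m → Subset n) (N : Fin m → Subset m) {k D : ℕ}
  (∣E∣≡1+k : ∀ j → ∣ E j ∣ ≡ suc k)
  (∣N∣≤D : ∀ j → ∣ N j ∣ ≤ D)
  (N-covers : ∀ {i j} → i ≢ j → i ∉ N j → ∀ {v} → v ∈ E i → v ∉ E j)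
  ([1+D]^[1+D]≤q^k*D^D : suc D ^ suc D ≤ q ^ k * D ^ D)
  where

  ProperOn : Subset m → Colouring n q → Set
  ProperOn J X = ∀ j → j ∈ J → ¬ Monochromatic (E j) X

  properOn? : ∀ J → Decidable (ProperOn J)
  properOn? J X = all? λ j → (j ∈? J) →-dec ¬? (monochromatic? (E j) X)

  #proper : Subset m → ℕ
  #proper J = countCol n q (properOn? J)

  #monochromatic : Subset m → Fin m → ℕ
  #monochromatic J j = countCol n q (properOn? J ∩? monochromatic? (E j))

  properOn-antitone : ∀ {J J′ X} → J ⊆ J′ → ProperOn J′ X → ProperOn J X
  properOn-antitone J⊆J′ proper j j∈J = proper j (J⊆J′ j∈J)

  properOn-insert : ∀ {J j X} → j ∈ J → ProperOn (J - j) X → ¬ Monochromatic (E j) X → ProperOn J X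
  properOn-insert {j = j} j∈J proper ¬mono i i∈J with i ≟ᶠ j
  ... | yes refl = ¬mono
  ... | no  i≢j  = proper i (x∈p∧x≢y⇒x∈p-y i∈J i≢j)

  #proper-antitone : ∀ {J J′} → J ⊆ J′ → #proper J′ ≤ #proper J
  #proper-antitone J⊆J′ = countCol-mono n (properOn? _) (properOn? _) (properOn-antitone J⊆J′)

  #monochromatic-antitone : ∀ {J J′ j} → J ⊆ J′ → #monochromatic J′ j ≤ #monochromatic J j
  #monochromatic-antitone J⊆J′ = countCol-mono n _ _ (map₁ (properOn-antitone J⊆J′))

  #proper-remove : ∀ {J j} → j ∈ J → #proper (J - j) ≡ #proper J + #monochromatic (J - j) j
  #proper-remove {J} {j} j∈J = begin-equality
    #proper (J - j)
      ≡⟨ countCol-split n (properOn? (J - j)) (monochromatic? (E j)) ⟩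
    countCol n q (properOn? (J - j) ∩? ∁? (monochromatic? (E j))) + #monochromatic (J - j) j
      ≡⟨ cong (_+ #monochromatic (J - j) j) (countCol-cong n _ (properOn? J)
           (uncurry (properOn-insert j∈J) , λ proper → properOn-antitone (p─q⊆p J ⁅ j ⁆) proper , proper j j∈J)) ⟩
    #proper J + #monochromatic (J - j) j
      ∎

  Bound : Subset m → Fin m → Set
  Bound J j = #monochromatic J j * suc D ≤ #proper J

  #proper-remove-ratio : ∀ {J j} → j ∈ J → Bound (J - j) j → #proper (J - j) * D ≤ #proper J * suc D
  #proper-remove-ratio {J} {j} j∈J bound = +-cancelʳ-≤ p₋ (p₋ * D) (p * suc D) (begin
    p₋ * D + p₋              ≡⟨ trans (+-comm (p₋ * D) p₋) (sym (*-suc p₋ D)) ⟩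
    p₋ * suc D               ≡⟨ cong (_* suc D) (#proper-remove j∈J) ⟩
    (p + m₋) * suc D         ≡⟨ *-distribʳ-+ (suc D) p m₋ ⟩
    p * suc D + m₋ * suc D   ≤⟨ +-monoʳ-≤ (p * suc D) bound ⟩
    p * suc D + p₋           ∎)
    where
    p p₋ m₋ : ℕ
    p = #proper J
    p₋ = #proper (J - j)
    m₋ = #monochromatic (J - j) j

  #proper-─-ratio : ∀ {I} → (∀ {J} → J ⊂ I → ∀ {j} → j ∉ J → Bound J j) →
                    ∀ S r {J} → J ⊆ I → ∣ J ∩ S ∣ ≤ r → #proper (J ─ S) * D ^ r ≤ #proper J * suc D ^ r
  #proper-─-ratio {I} bound S r {J} J⊆I ∣J∩S∣≤r with nonempty? (J ∩ S)
  ... | no J∩S≡∅ = *-mono-≤ (#proper-antitone J⊆J─S) (^-monoˡ-≤ r (n≤1+n D))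
    where
    J⊆J─S : J ⊆ J ─ S
    J⊆J─S {i} i∈J = x∈p∧x∉q⇒x∈p─q i∈J λ i∈S → J∩S≡∅ (i , x∈p∩q⁺ (i∈J , i∈S))
  ... | yes (ĵ , ĵ∈J∩S) with r | ∣J∩S∣≤r
  ...   | zero  | ∣J∩S∣≤0   = contradiction (≤-trans (x∈p⇒∣p-x∣<∣p∣ ĵ∈J∩S) ∣J∩S∣≤0) λ ()
  ...   | suc r | ∣J∩S∣≤1+r = begin
    #proper (J ─ S) * (D * D ^ r)     ≤⟨ *-monoˡ-≤ (D * D ^ r) (#proper-antitone J′─S⊆J─S) ⟩
    #proper (J′ ─ S) * (D * D ^ r)    ≡⟨ *ℕ.x∙yz≈y∙xz (#proper (J′ ─ S)) D (D ^ r) ⟩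
    D * (#proper (J′ ─ S) * D ^ r)    ≤⟨ *-monoʳ-≤ D (#proper-─-ratio bound S r (⊆-trans J′⊆J J⊆I) ∣J′∩S∣≤r) ⟩
    D * (#proper J′ * suc D ^ r)      ≡⟨ *ℕ.x∙yz≈yx∙z D (#proper J′) (suc D ^ r) ⟩
    #proper J′ * D * suc D ^ r        ≤⟨ *-monoˡ-≤ (suc D ^ r) (#proper-remove-ratio ĵ∈J (bound J′⊂I (x∉p-x J ĵ))) ⟩
    #proper J * suc D * suc D ^ r     ≡⟨ *-assoc (#proper J) (suc D) (suc D ^ r) ⟩
    #proper J * (suc D * suc D ^ r)   ∎
    where
    J′ : Subset m
    J′ = J - ĵ
    ĵ∈J : ĵ ∈ J
    ĵ∈J = proj₁ (x∈p∩q⁻ J S ĵ∈J∩S)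
    J′⊆J : J′ ⊆ J
    J′⊆J = p─q⊆p J ⁅ ĵ ⁆
    J′⊂I : J′ ⊂ I
    J′⊂I = ⊂-⊆-trans (x∈p⇒p-x⊂p ĵ∈J) J⊆I
    J′─S⊆J─S : J′ ─ S ⊆ J ─ S
    J′─S⊆J─S i∈J′─S = x∈p∧x∉q⇒x∈p─q (J′⊆J (p─q⊆p J′ S i∈J′─S)) (x∈p─q⇒x∉q J′ S i∈J′─S)
    J′∩S⊂J∩S : J′ ∩ S ⊂ J ∩ S
    J′∩S⊂J∩S = (λ i∈J′∩S → let i∈J′ , i∈S = x∈p∩q⁻ J′ S i∈J′∩S in x∈p∩q⁺ (J′⊆J i∈J′ , i∈S))
             , ĵ , ĵ∈J∩S , λ ĵ∈J′∩S → x∉p-x J ĵ (proj₁ (x∈p∩q⁻ J′ S ĵ∈J′∩S))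
    ∣J′∩S∣≤r : ∣ J′ ∩ S ∣ ≤ r
    ∣J′∩S∣≤r = ≤-pred (≤-trans (p⊂q⇒∣p∣<∣q∣ J′∩S⊂J∩S) ∣J∩S∣≤1+r)

  properOn-ignores : ∀ {I j₀} → j₀ ∉ I → IgnoresColoursOn (E j₀) (ProperOn (I ─ N j₀))
  properOn-ignores {I} {j₀} j₀∉I X≡Y properX j j∈I─N (c , Y≡c) =
    properX j j∈I─N (c , λ v v∈Ej → trans (X≡Y v (N-covers j≢j₀ (x∈p─q⇒x∉q I (N j₀) j∈I─N) v∈Ej)) (Y≡c v v∈Ej))
    where
    j≢j₀ : j ≢ j₀
    j≢j₀ refl = j₀∉I (p─q⊆p I (N j₀) j∈I─N)

  bound : ∀ J {j} → j ∉ J → Bound J j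
  bound = WF.All.wfRec ⊂-wellFounded 0ℓ (λ J → ∀ {j} → j ∉ J → Bound J j) step
    where
    step : ∀ I → (∀ {J} → J ⊂ I → ∀ {j} → j ∉ J → Bound J j) → ∀ {j} → j ∉ I → Bound I j
    step I bound′ {j₀} j₀∉I = *-cancelʳ-≤ _ _ (suc D ^ D) {{m^n≢0 (suc D) D}} (begin
      #monochromatic I j₀ * suc D * suc D ^ D
        ≡⟨ *-assoc (#monochromatic I j₀) (suc D) (suc D ^ D) ⟩
      #monochromatic I j₀ * suc D ^ suc D
        ≤⟨ *-mono-≤ (#monochromatic-antitone (p─q⊆p I (N j₀))) [1+D]^[1+D]≤q^k*D^D ⟩
      #monochromatic I₂ j₀ * (q ^ k * D ^ D)
        ≡⟨ *-assoc (#monochromatic I₂ j₀) (q ^ k) (D ^ D) ⟨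
      #monochromatic I₂ j₀ * q ^ k * D ^ D
        ≤⟨ *-monoˡ-≤ (D ^ D) (countCol-monochromatic n (E j₀) (properOn? I₂) (properOn-ignores j₀∉I) (∣E∣≡1+k j₀)) ⟩
      #proper I₂ * D ^ D
        ≤⟨ #proper-─-ratio bound′ (N j₀) D (λ i∈I → i∈I) (≤-trans (∣p∩q∣≤∣q∣ I (N j₀)) (∣N∣≤D j₀)) ⟩
      #proper I * suc D ^ D
        ∎)
      where
      I₂ : Subset m
      I₂ = I ─ N j₀

-- Neighbourhoods in a hypergraph

edgesAt : ∀ {n} (es : List (Subset n)) → Fin n → Subset (length es)
edgesAt es v = tabulate λ j → does (v ∈? lookup es j)

∈-edgesAt : ∀ {n} (es : List (Subset n)) {v j} → v ∈ lookup es j → j ∈ edgesAt es v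
∈-edgesAt es {v} {j} v∈ej = lookup⇒[]= j _ (trans (lookup∘tabulate _ j) (dec-true (v ∈? lookup es j) v∈ej))

∣edgesAt∣≡degree : ∀ {n} (es : List (Subset n)) v → ∣ edgesAt es v ∣ ≡ degree es v
∣edgesAt∣≡degree []       v = refl
∣edgesAt∣≡degree (e ∷ es) v with v ∈? e
... | yes _ = cong suc (∣edgesAt∣≡degree es v)
... | no  _ = ∣edgesAt∣≡degree es v

neighbours : ∀ {n} (es : List (Subset n)) → Fin (length es) → Subset (length es)
neighbours es j = ⋃∈ (lookup es j) λ v → edgesAt es v - j

neighbours-cover : ∀ {n} (es : List (Subset n)) {i j} → i ≢ j → i ∉ neighbours es j →
                   ∀ {v} → v ∈ lookup es i → v ∉ lookup es j
neighbours-cover es i≢j i∉Nj v∈ei v∈ej = i∉Nj (∈-⋃∈ v∈ej (x∈p∧x≢y⇒x∈p-y (∈-edgesAt es v∈ei) i≢j))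

∣neighbours∣≤ : ∀ {n Δ} (es : List (Subset n)) → MaxDegreeAtMost es Δ →
                ∀ j → ∣ neighbours es j ∣ ≤ ∣ lookup es j ∣ * pred Δ
∣neighbours∣≤ {Δ = Δ} es maxDegree j = ∣⋃∈∣≤ (lookup es j) λ {v} v∈ej → <⇒≤pred (begin-strict
  ∣ edgesAt es v - j ∣  <⟨ x∈p⇒∣p-x∣<∣p∣ (∈-edgesAt es v∈ej) ⟩
  ∣ edgesAt es v ∣      ≡⟨ ∣edgesAt∣≡degree es v ⟩
  degree es v           ≤⟨ maxDegree v ⟩
  Δ                     ∎)

prefix : ∀ {a} {A : Set a} (xs : List A) → ℕ → Subset (length xs)
prefix []       t       = []
prefix (x ∷ xs) zero    = outside ∷ prefix xs zero
prefix (x ∷ xs) (suc t) = inside ∷ prefix xs t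

∉prefix : ∀ {a} {A : Set a} (xs : List A) (i : Fin (length xs)) → i ∉ prefix xs (toℕ i)
∉prefix (x ∷ xs) zero    ()
∉prefix (x ∷ xs) (suc i) (there i∈) = ∉prefix xs i i∈

module _ {a p} {A : Set a} {Q : A → Set p} where

  All-take⇒ : ∀ xs t → All Q (take t xs) → ∀ j → j ∈ prefix xs t → Q (lookup xs j)
  All-take⇒ (x ∷ xs) zero    _          (suc j) (there j∈) = All-take⇒ xs zero [] j j∈
  All-take⇒ (x ∷ xs) (suc t) (qx ∷ _)   zero    here       = qx
  All-take⇒ (x ∷ xs) (suc t) (_  ∷ qxs) (suc j) (there j∈) = All-take⇒ xs t qxs j j∈

  All-take⇐ : ∀ xs t → (∀ j → j ∈ prefix xs t → Q (lookup xs j)) → All Q (take t xs)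
  All-take⇐ []       zero    _   = []
  All-take⇐ []       (suc t) _   = []
  All-take⇐ (x ∷ xs) zero    _   = []
  All-take⇐ (x ∷ xs) (suc t) all = all zero here ∷ All-take⇐ xs t λ j j∈ → all (suc j) (there j∈)

proper-take-monochromatic-bound :
  ∀ {n q k Δ D} (es : List (Subset n)) → Uniform (suc k) es → MaxDegreeAtMost es Δ →
  suc k * pred Δ ≤ D → suc D ^ suc D ≤ q ^ k * D ^ D → (i : Fin (length es)) →
  countCol n q (proper? (take (toℕ i) es) ∩? monochromatic? (lookup es i)) * suc D
    ≤ countCol n q (proper? (take (toℕ i) es))
proper-take-monochromatic-bound {n} {q} {k} {Δ} {D} es uniform maxDegree k*Δ≤D [1+D]^[1+D]≤q^k*D^D i = begin
  countCol n q (proper? before ∩? monochromatic? (lookup es i)) * suc D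
    ≡⟨ cong (_* suc D) (countCol-cong n _ _ (map₁ (All-take⇒ es t) , map₁ (All-take⇐ es t))) ⟩
  #monochromatic I i * suc D
    ≤⟨ bound I (∉prefix es i) ⟩
  #proper I
    ≡⟨ countCol-cong n _ _ (All-take⇐ es t , All-take⇒ es t) ⟩
  countCol n q (proper? before)
    ∎
  where
  t : ℕ
  t = toℕ i
  before : List (Subset n)
  before = take t es
  I : Subset (length es)
  I = prefix es t
  ∣eⱼ∣≡1+k : ∀ j → ∣ lookup es j ∣ ≡ suc k
  ∣eⱼ∣≡1+k j = All.lookup uniform (∈-lookup j)
  ∣N∣≤D : ∀ j → ∣ neighbours es j ∣ ≤ D
  ∣N∣≤D j = ≤-trans (∣neighbours∣≤ es maxDegree j) (≤-trans (≤-reflexive (cong (_* pred Δ) (∣eⱼ∣≡1+k j))) k*Δ≤D)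
  open CountingLocalLemma {q = q} (lookup es) (neighbours es) ∣eⱼ∣≡1+k ∣N∣≤D (neighbours-cover es) [1+D]^[1+D]≤q^k*D^D

a≡b+c⇒c*2≤a⇒a≤2*b : ∀ {a b c} → a ≡ b + c → c * 2 ≤ a → a ≤ 2 * b
a≡b+c⇒c*2≤a⇒a≤2*b {a} {b} {c} refl c*2≤a = begin
  b + c      ≤⟨ +-monoʳ-≤ b c≤b ⟩
  b + b      ≡⟨ cong (b +_) (+-identityʳ b) ⟨
  2 * b      ∎
  where
  c≤b : c ≤ b
  c≤b = +-cancelʳ-≤ c c b (begin
    c + c      ≡⟨ cong (c +_) (*-identityʳ c) ⟨
    c + c * 1  ≡⟨ *-suc c 1 ⟨
    c * 2      ≤⟨ c*2≤a ⟩
    b + c      ∎)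

-- The edges are handled through their positions in es.
lemma6p1 : (n k Δ q : ℕ) (es : List (Subset n)) →
    Unique es → Uniform k es → MaxDegreeAtMost es Δ →
    k ≥ 2 → Δ ≥ 2 → ColourBound q Δ k →
    (i : Fin (length es)) →
    countCol n q (proper? (take (toℕ i) es))
      ≤ 2 * countCol n q (λ X → proper? (take (toℕ i) es) X ×-dec ¬? (monochromatic? (lookup es i) X))
lemma6p1 n k@(suc (suc k′)) Δ@(suc (suc Δ′)) q es _ uniform maxDegree (s≤s (s≤s z≤n)) (s≤s (s≤s z≤n)) colourBound i =
  a≡b+c⇒c*2≤a⇒a≤2*b {c = #monochromatic} (countCol-split n (proper? before) (monochromatic? (lookup es i))) (begin
    #monochromatic * 2             ≤⟨ *-monoʳ-≤ #monochromatic (s≤s (s≤s z≤n)) ⟩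
    #monochromatic * suc D         ≤⟨ proper-take-monochromatic-bound es uniform maxDegree ≤-refl [1+D]^[1+D]≤q^[k-1]*D^D i ⟩
    countCol n q (proper? before)  ∎)
  where
  before : List (Subset n)
  before = take (toℕ i) es
  #monochromatic D : ℕ
  #monochromatic = countCol n q (proper? before ∩? monochromatic? (lookup es i))
  D = k * suc Δ′
  1+D≤Δ*k : suc D ≤ Δ * k
  1+D≤Δ*k = begin
    1 + k * suc Δ′  ≡⟨ cong (1 +_) (*-comm k (suc Δ′)) ⟩
    1 + suc Δ′ * k  ≤⟨ +-monoˡ-≤ (suc Δ′ * k) (s≤s (z≤n {suc k′})) ⟩
    k + suc Δ′ * k  ∎
  [1+D]^[1+D]≤q^[k-1]*D^D : suc D ^ suc D ≤ q ^ (k ∸ 1) * D ^ D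
  [1+D]^[1+D]≤q^[k-1]*D^D = GtEulerTimes⇒[1+D]^[1+D]≤*D^D {a = q ^ (k ∸ 1)} {b = Δ * k} colourBound 1+D≤Δ*k
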